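{- Let $C$ be a finite simple graph that has no vertex cover of size at most $1$ and has exactly $3$ vertex covers of size $2$. Then $C$ is either the disjoint union of a $K_3$ with isolated vertices, or the disjoint union of a path $P_4$ (on 4 vertices) with isolated vertices.
   Context: A vertex cover of a graph is a set $S$ of vertices such that every edge has at least one endpoint in $S$; the vertex covers of size $k$ are counted as distinct $k$-element vertex subsets. -}

module Defs where

open import Data.Nat using (ℕ; zero; suc)
open import Data.Bool using (Bool; true; false)
open import Data.Fin using (Fin)
open import Data.Fin.Subset using (Subset; inside; outside; _∈_; ∣_∣)
open import Data.Fin.Subset.Properties using (_∈?_)
open import Data.Fin.Properties using (all?)
open import Data.Vec using (Vec; []; _∷_)
open import Data.List using (List; []; _∷_; [_]; _++_; map; filter; length)
open import Data.Sum using (_⊎_)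
open import Data.Product using (_×_; ∃-syntax)
open import Function.Bundles using (_⇔_)
open import Relation.Nullary using (Dec; yes; no)
open import Relation.Nullary.Decidable using (_×-dec_; _⊎-dec_; _→-dec_)
open import Relation.Binary.PropositionalEquality using (_≡_; _≢_)
import Data.Nat as ℕ
import Data.Bool as B

record Graph (n : ℕ) : Set where
  field
    adj    : Fin n → Fin n → Bool
    sym    : ∀ u v → adj u v ≡ adj v u
    irrefl : ∀ v → adj v v ≡ false
open Graph public

Adj : ∀ {n} → Graph n → Fin n → Fin n → Set
Adj G u v = adj G u v ≡ true

IsVertexCover : ∀ {n} → Graph n → Subset n → Set
IsVertexCover G S = ∀ u v → Adj G u v → (u ∈ S) ⊎ (v ∈ S)

isVertexCover? : ∀ {n} (G : Graph n) (S : Subset n) → Dec (IsVertexCover G S)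
isVertexCover? G S =
  all? λ u → all? λ v → (adj G u v B.≟ true) →-dec ((u ∈? S) ⊎-dec (v ∈? S))

allSubsets : (n : ℕ) → List (Subset n)
allSubsets zero = [ [] ]
allSubsets (suc n) = map (inside ∷_) (allSubsets n) ++ map (outside ∷_) (allSubsets n)

numCovers : ∀ {n} → Graph n → ℕ → ℕ
numCovers {n} G k =
  length (filter (λ S → (∣ S ∣ ℕ.≟ k) ×-dec isVertexCover? G S) (allSubsets n))

SamePair : ∀ {n} → Fin n → Fin n → Fin n → Fin n → Set
SamePair a b u v = ((u ≡ a) × (v ≡ b)) ⊎ ((u ≡ b) × (v ≡ a))

IsK3PlusIsolated : ∀ {n} → Graph n → Set
IsK3PlusIsolated {n} G =
  ∃[ a ] ∃[ b ] ∃[ c ]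
    (a ≢ b) × (b ≢ c) × (a ≢ c) ×
    (∀ u v → Adj G u v ⇔ (SamePair a b u v ⊎ SamePair b c u v ⊎ SamePair c a u v))

IsP4PlusIsolated : ∀ {n} → Graph n → Set
IsP4PlusIsolated {n} G =
  ∃[ a ] ∃[ b ] ∃[ c ] ∃[ d ]
    (a ≢ b) × (a ≢ c) × (a ≢ d) × (b ≢ c) × (b ≢ d) × (c ≢ d) ×
    (∀ u v → Adj G u v ⇔ (SamePair a b u v ⊎ SamePair b c u v ⊎ SamePair c d u v))

-- Among three distinct covers of size two, either two are disjoint or all three
-- pairwise meet. If all three share a vertex p, an edge avoiding p would have to
-- contain the three other endpoints, so {p} would be a cover; hence they form a
-- triangle {p,q₁}, {p,q₂}, {q₁,q₂}, every edge lies inside it, and each of its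
-- edges is present since otherwise a single vertex covers. If {a,b} and {c,d}
-- are disjoint covers, every edge joins them; the third cover is then a crossing
-- pair, say {b,c}, which excludes the edge ad, and ac, cb, bd are all present,
-- because dropping one leaves a cover of size one or a fourth cover {a,d}: the
-- edges form the path a – c – b – d.
module Submission where

open import Defs
open import Data.Bool as Bool using (true)
open import Data.Empty using (⊥-elim)
open import Data.Fin using (Fin; zero; suc; _≟_)
import Data.Fin.Properties as Fin
open import Data.Fin.Subset using (Subset; inside; outside; ⊥; ⁅_⁆; _∪_; _∈_; ∣_∣)
open import Data.Fin.Subset.Properties
  using (x∈⁅x⁆; x∈⁅y⁆⇒x≡y; ∣⁅x⁆∣≡1; x∈p∪q⁺; x∈p∪q⁻; ∪-comm; ∪-identityˡ; ∪-identityʳ)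
open import Data.List using (List; []; _∷_; length; filter; map)
import Data.List.Membership.Propositional as List
open import Data.List.Membership.Propositional.Properties
  using (∈-map⁺; ∈-map⁻; ∈-++⁺ˡ; ∈-++⁺ʳ; ∈-filter⁺; ∈-filter⁻)
open import Data.List.Relation.Unary.All using ([]; _∷_)
open import Data.List.Relation.Unary.AllPairs using ([]; _∷_)
open import Data.List.Relation.Unary.Any using (here; there)
open import Data.List.Relation.Unary.Unique.Propositional using (Unique)
import Data.List.Relation.Unary.Unique.Propositional.Properties as Unique
open import Data.Nat using (ℕ; zero; suc)
import Data.Nat as ℕ
import Data.Nat.Properties as ℕ
open import Data.Product using (_×_; _,_; proj₂; ∃-syntax)
import Data.Product as Prod
open import Data.Sum using (_⊎_; inj₁; inj₂; [_,_])
import Data.Sum as Sum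
open import Data.Vec using ([]; _∷_)
open import Data.Vec.Properties using (∷-injectiveʳ)
open import Function using (_∘_; id)
open import Function.Bundles using (mk⇔)
open import Relation.Binary.PropositionalEquality using (_≡_; _≢_; refl; cong; trans; subst)
import Relation.Binary.PropositionalEquality as ≡
open import Relation.Nullary using (¬_; Dec; yes; no)
open import Relation.Nullary.Decidable using (_×-dec_; _⊎-dec_; decidable-stable)

∈⇒length≢0 : ∀ {A : Set} {x : A} {xs : List A} → x List.∈ xs → length xs ≢ 0
∈⇒length≢0 (here _) ()
∈⇒length≢0 (there _) ()

allSubsets-complete : ∀ {n} (S : Subset n) → S List.∈ allSubsets n
allSubsets-complete [] = here refl
allSubsets-complete (inside ∷ S) = ∈-++⁺ˡ (∈-map⁺ (inside ∷_) (allSubsets-complete S))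
allSubsets-complete {suc n} (outside ∷ S) =
  ∈-++⁺ʳ (map (inside ∷_) (allSubsets n)) (∈-map⁺ (outside ∷_) (allSubsets-complete S))

allSubsets-unique : ∀ n → Unique (allSubsets n)
allSubsets-unique zero = [] ∷ []
allSubsets-unique (suc n) =
  Unique.++⁺ (Unique.map⁺ ∷-injectiveʳ (allSubsets-unique n))
             (Unique.map⁺ ∷-injectiveʳ (allSubsets-unique n))
             inside≢outside
  where
  inside≢outside : ∀ {S} → ¬ (S List.∈ map (inside ∷_) (allSubsets n) ×
                             S List.∈ map (outside ∷_) (allSubsets n))
  inside≢outside (S∈ , S∈′) with ∈-map⁻ (inside ∷_) S∈ | ∈-map⁻ (outside ∷_) S∈′
  ... | _ , _ , refl | _ , _ , ()

∣p∣≡0⇒p≡⊥ : ∀ {n} (S : Subset n) → ∣ S ∣ ≡ 0 → S ≡ ⊥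
∣p∣≡0⇒p≡⊥ [] _ = refl
∣p∣≡0⇒p≡⊥ (outside ∷ S) ∣S∣≡0 = cong (outside ∷_) (∣p∣≡0⇒p≡⊥ S ∣S∣≡0)

∣p∣≡1⇒p≡⁅x⁆ : ∀ {n} (S : Subset n) → ∣ S ∣ ≡ 1 → ∃[ x ] S ≡ ⁅ x ⁆
∣p∣≡1⇒p≡⁅x⁆ (inside ∷ S) ∣S∣≡1 = zero , cong (inside ∷_) (∣p∣≡0⇒p≡⊥ S (ℕ.suc-injective ∣S∣≡1))
∣p∣≡1⇒p≡⁅x⁆ (outside ∷ S) ∣S∣≡1 with ∣p∣≡1⇒p≡⁅x⁆ S ∣S∣≡1
... | x , refl = suc x , refl

∣p∣≡2⇒p≡⁅x⁆∪⁅y⁆ : ∀ {n} (S : Subset n) → ∣ S ∣ ≡ 2 →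
                  ∃[ x ] ∃[ y ] x ≢ y × S ≡ ⁅ x ⁆ ∪ ⁅ y ⁆
∣p∣≡2⇒p≡⁅x⁆∪⁅y⁆ (inside ∷ S) ∣S∣≡2 with ∣p∣≡1⇒p≡⁅x⁆ S (ℕ.suc-injective ∣S∣≡2)
... | y , refl = zero , suc y , (λ ()) , cong (inside ∷_) (≡.sym (∪-identityˡ ⁅ y ⁆))
∣p∣≡2⇒p≡⁅x⁆∪⁅y⁆ (outside ∷ S) ∣S∣≡2 with ∣p∣≡2⇒p≡⁅x⁆∪⁅y⁆ S ∣S∣≡2
... | x , y , x≢y , refl = suc x , suc y , x≢y ∘ Fin.suc-injective , refl

∣⁅x⁆∪⁅y⁆∣≡2 : ∀ {n} (x y : Fin n) → x ≢ y → ∣ ⁅ x ⁆ ∪ ⁅ y ⁆ ∣ ≡ 2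
∣⁅x⁆∪⁅y⁆∣≡2 zero zero x≢y = ⊥-elim (x≢y refl)
∣⁅x⁆∪⁅y⁆∣≡2 zero (suc y) _ = cong suc (trans (cong ∣_∣ (∪-identityˡ ⁅ y ⁆)) (∣⁅x⁆∣≡1 y))
∣⁅x⁆∪⁅y⁆∣≡2 (suc x) zero _ = cong suc (trans (cong ∣_∣ (∪-identityʳ ⁅ x ⁆)) (∣⁅x⁆∣≡1 x))
∣⁅x⁆∪⁅y⁆∣≡2 (suc x) (suc y) x≢y = ∣⁅x⁆∪⁅y⁆∣≡2 x y (x≢y ∘ cong suc)

module _ {n : ℕ} where

  private
    variable
      a b c d p q u v w x y z : Fin n

  _∈⟨_,_⟩ : Fin n → Fin n → Fin n → Set
  z ∈⟨ x , y ⟩ = z ≡ x ⊎ z ≡ y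

  _∈⟨_,_⟩? : (z x y : Fin n) → Dec (z ∈⟨ x , y ⟩)
  z ∈⟨ x , y ⟩? = (z ≟ x) ⊎-dec (z ≟ y)

  ∈⁅x⁆∪⁅y⁆⁻ : z ∈ ⁅ x ⁆ ∪ ⁅ y ⁆ → z ∈⟨ x , y ⟩
  ∈⁅x⁆∪⁅y⁆⁻ = Sum.map (x∈⁅y⁆⇒x≡y _) (x∈⁅y⁆⇒x≡y _) ∘ x∈p∪q⁻ _ _

  ∈⁅x⁆∪⁅y⁆⁺ : z ∈⟨ x , y ⟩ → z ∈ ⁅ x ⁆ ∪ ⁅ y ⁆
  ∈⁅x⁆∪⁅y⁆⁺ (inj₁ refl) = x∈p∪q⁺ (inj₁ (x∈⁅x⁆ _))
  ∈⁅x⁆∪⁅y⁆⁺ (inj₂ refl) = x∈p∪q⁺ (inj₂ (x∈⁅x⁆ _))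

  SamePair-swapˡ : SamePair a b u v → SamePair b a u v
  SamePair-swapˡ = Sum.swap

  SamePair-refl : SamePair a b a b
  SamePair-refl = inj₁ (refl , refl)

  SamePair-swapʳ : SamePair a b u v → SamePair a b v u
  SamePair-swapʳ = Sum.swap ∘ Sum.map Prod.swap Prod.swap

  SamePair-sym : SamePair a b u v → SamePair u v a b
  SamePair-sym (inj₁ (refl , refl)) = inj₁ (refl , refl)
  SamePair-sym (inj₂ (refl , refl)) = inj₂ (refl , refl)

  SamePair-trans : SamePair a b u v → SamePair u v x y → SamePair a b x y
  SamePair-trans (inj₁ (refl , refl)) s = s
  SamePair-trans (inj₂ (refl , refl)) s = SamePair-swapˡ s

  SamePair-any : (P : Fin n → Set) → SamePair a b u v → P a ⊎ P b → P u ⊎ P v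
  SamePair-any P (inj₁ (refl , refl)) = id
  SamePair-any P (inj₂ (refl , refl)) = Sum.swap

  SamePair⇒∈ˡ : SamePair a b u v → u ∈⟨ a , b ⟩
  SamePair⇒∈ˡ = Sum.map Prod.proj₁ Prod.proj₁

  SamePair⇒∈ʳ : SamePair a b u v → v ∈⟨ a , b ⟩
  SamePair⇒∈ʳ = Sum.swap ∘ Sum.map proj₂ proj₂

  SamePair-≢ : a ≢ b → SamePair a b u v → u ≢ v
  SamePair-≢ a≢b (inj₁ (refl , refl)) = a≢b
  SamePair-≢ a≢b (inj₂ (refl , refl)) = a≢b ∘ ≡.sym

  ∈⟨⟩⇒SamePair : u ∈⟨ a , b ⟩ → v ∈⟨ a , b ⟩ → u ≢ v → SamePair a b u v
  ∈⟨⟩⇒SamePair (inj₁ refl) (inj₁ refl) u≢v = ⊥-elim (u≢v refl)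
  ∈⟨⟩⇒SamePair (inj₁ refl) (inj₂ refl) _ = inj₁ (refl , refl)
  ∈⟨⟩⇒SamePair (inj₂ refl) (inj₁ refl) _ = inj₂ (refl , refl)
  ∈⟨⟩⇒SamePair (inj₂ refl) (inj₂ refl) u≢v = ⊥-elim (u≢v refl)

  partner : z ∈⟨ a , b ⟩ → ∃[ z′ ] SamePair a b z z′
  partner {a = a} {b} (inj₁ refl) = b , SamePair-refl
  partner {a = a} {b} (inj₂ refl) = a , inj₂ (refl , refl)

  partners-distinct : ¬ SamePair a b c d → SamePair a b p q → SamePair c d p w → q ≢ w
  partners-distinct ab≁cd s₁ s₂ refl = ab≁cd (SamePair-trans s₁ (SamePair-sym s₂))

  SamePair⇒⁅⁆∪⁅⁆≡ : SamePair a b u v → ⁅ a ⁆ ∪ ⁅ b ⁆ ≡ ⁅ u ⁆ ∪ ⁅ v ⁆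
  SamePair⇒⁅⁆∪⁅⁆≡ (inj₁ (refl , refl)) = refl
  SamePair⇒⁅⁆∪⁅⁆≡ {a = a} {b} (inj₂ (refl , refl)) = ∪-comm ⁅ a ⁆ ⁅ b ⁆

  ⁅⁆∪⁅⁆≡⇒SamePair : u ≢ v → ⁅ u ⁆ ∪ ⁅ v ⁆ ≡ ⁅ a ⁆ ∪ ⁅ b ⁆ → SamePair a b u v
  ⁅⁆∪⁅⁆≡⇒SamePair {u} {v} {a} {b} u≢v eq =
    ∈⟨⟩⇒SamePair (member (inj₁ refl)) (member (inj₂ refl)) u≢v
    where
    member : ∀ {z} → z ∈⟨ u , v ⟩ → z ∈⟨ a , b ⟩
    member {z} = ∈⁅x⁆∪⁅y⁆⁻ ∘ subst (z ∈_) eq ∘ ∈⁅x⁆∪⁅y⁆⁺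

  Meets : Fin n → Fin n → Fin n → Fin n → Set
  Meets a b c d = ∃[ z ] z ∈⟨ a , b ⟩ × z ∈⟨ c , d ⟩

  meets? : (a b c d : Fin n) → Dec (Meets a b c d)
  meets? a b c d with a ∈⟨ c , d ⟩? | b ∈⟨ c , d ⟩?
  ... | yes a∈cd | _ = yes (a , inj₁ refl , a∈cd)
  ... | no _ | yes b∈cd = yes (b , inj₂ refl , b∈cd)
  ... | no a∉cd | no b∉cd = no λ { (_ , inj₁ refl , a∈cd) → a∉cd a∈cd
                                 ; (_ , inj₂ refl , b∈cd) → b∉cd b∈cd }

  Meets-SamePair : SamePair a b u v → SamePair c d x y → Meets a b c d → Meets u v x y
  Meets-SamePair s₁ s₂ (z , z∈ab , z∈cd) = z , SamePair-any (z ≡_) s₁ z∈ab , SamePair-any (z ≡_) s₂ z∈cd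

  Meets-via-partner : ¬ a ∈⟨ c , d ⟩ → Meets a b c d → b ∈⟨ c , d ⟩
  Meets-via-partner a∉cd (_ , inj₁ refl , a∈cd) = ⊥-elim (a∉cd a∈cd)
  Meets-via-partner a∉cd (_ , inj₂ refl , b∈cd) = b∈cd

  ¬Meets⇒≢ : ¬ Meets a b c d → z ∈⟨ a , b ⟩ → w ∈⟨ c , d ⟩ → z ≢ w
  ¬Meets⇒≢ ab∩cd=∅ z∈ab w∈cd refl = ab∩cd=∅ (_ , z∈ab , w∈cd)

  Crossing : Fin n → Fin n → Fin n → Fin n → Fin n → Fin n → Set
  Crossing a b c d u v = ∃[ s ] ∃[ t ] s ∈⟨ a , b ⟩ × t ∈⟨ c , d ⟩ × SamePair s t u v

  Crossing-endpoint : Crossing a b c d u v → u ∈⟨ a , b ⟩ ⊎ u ∈⟨ c , d ⟩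
  Crossing-endpoint (_ , _ , s∈ab , _ , inj₁ (refl , _)) = inj₁ s∈ab
  Crossing-endpoint (_ , _ , _ , t∈cd , inj₂ (refl , _)) = inj₂ t∈cd

  module _ (G : Graph n) where

    Adj-sym : Adj G u v → Adj G v u
    Adj-sym {u} {v} e = trans (Graph.sym G v u) e

    Adj-stable : ¬ ¬ Adj G u v → Adj G u v
    Adj-stable {u} {v} = decidable-stable (adj G u v Bool.≟ true)

    Adj-SamePair : Adj G a b → SamePair a b u v → Adj G u v
    Adj-SamePair e (inj₁ (refl , refl)) = e
    Adj-SamePair e (inj₂ (refl , refl)) = Adj-sym e

    EdgeCovered : (Fin n → Set) → Fin n → Fin n → Set
    EdgeCovered P u v = Adj G u v → P u ⊎ P v

    Cover : (Fin n → Set) → Set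
    Cover P = ∀ u v → EdgeCovered P u v

    EdgeCovered-SamePair : ∀ {P} → SamePair a b u v → EdgeCovered P a b → EdgeCovered P u v
    EdgeCovered-SamePair {P = P} s covered e =
      SamePair-any P s (covered (Adj-SamePair e (SamePair-sym s)))

    Cover-from-sides : ∀ {P} → (∀ {u v} → Adj G u v → SamePair a b u v ⊎ SamePair c d u v ⊎ SamePair x y u v) →
                       EdgeCovered P a b → EdgeCovered P c d → EdgeCovered P x y → Cover P
    Cover-from-sides sides h₁ h₂ h₃ u v e =
      [ (λ s → EdgeCovered-SamePair s h₁ e)
      , [ (λ s → EdgeCovered-SamePair s h₂ e) , (λ s → EdgeCovered-SamePair s h₃ e) ] ] (sides e)

    Cover-mono : ∀ {P Q : Fin n → Set} → (∀ {z} → P z → Q z) → Cover P → Cover Q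
    Cover-mono P⇒Q cover u v e = Sum.map P⇒Q P⇒Q (cover u v e)

    Cover-SamePair : SamePair a b u v → Cover (_∈⟨ a , b ⟩) → Cover (_∈⟨ u , v ⟩)
    Cover-SamePair s = Cover-mono (SamePair-any (_ ≡_) s)

    PairCover : Fin n → Fin n → Set
    PairCover x y = x ≢ y × Cover (_∈⟨ x , y ⟩)

    NoSingleCover : Set
    NoSingleCover = ∀ w → ¬ Cover (_≡ w)

    Cover⇒Meets : Cover (_∈⟨ x , y ⟩) → Adj G u v → Meets x y u v
    Cover⇒Meets {u = u} {v} cover e =
      [ (λ u∈xy → u , u∈xy , inj₁ refl) , (λ v∈xy → v , v∈xy , inj₂ refl) ] (cover u v e)

    isolated-cover : (∀ v → ¬ Adj G x v) → Cover (_∈⟨ x , y ⟩) → Cover (_≡ y)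
    isolated-cover isolated cover u v e with cover u v e
    ... | inj₁ (inj₁ refl) = ⊥-elim (isolated v e)
    ... | inj₁ (inj₂ u≡y) = inj₁ u≡y
    ... | inj₂ (inj₁ refl) = ⊥-elim (isolated u (Adj-sym e))
    ... | inj₂ (inj₂ v≡y) = inj₂ v≡y

    edge-at-or-between : Cover (_∈⟨ p , q ⟩) → Cover (_∈⟨ p , w ⟩) → q ≢ w →
                         Adj G u v → (u ≡ p ⊎ v ≡ p) ⊎ SamePair q w u v
    edge-at-or-between {u = u} {v} c₁ c₂ q≢w e with c₁ u v e | c₂ u v e
    ... | inj₁ (inj₁ u≡p) | _ = inj₁ (inj₁ u≡p)
    ... | inj₂ (inj₁ v≡p) | _ = inj₁ (inj₂ v≡p)
    ... | _ | inj₁ (inj₁ u≡p) = inj₁ (inj₁ u≡p)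
    ... | _ | inj₂ (inj₁ v≡p) = inj₁ (inj₂ v≡p)
    ... | inj₁ (inj₂ refl) | inj₁ (inj₂ u≡w) = ⊥-elim (q≢w u≡w)
    ... | inj₁ (inj₂ u≡q) | inj₂ (inj₂ v≡w) = inj₂ (inj₁ (u≡q , v≡w))
    ... | inj₂ (inj₂ v≡q) | inj₁ (inj₂ u≡w) = inj₂ (inj₂ (u≡w , v≡q))
    ... | inj₂ (inj₂ refl) | inj₂ (inj₂ v≡w) = ⊥-elim (q≢w v≡w)

    sunflower : ∀ {q₁ q₂ q₃} →
                Cover (_∈⟨ p , q₁ ⟩) → Cover (_∈⟨ p , q₂ ⟩) → Cover (_∈⟨ p , q₃ ⟩) →
                q₁ ≢ q₂ → q₁ ≢ q₃ → q₂ ≢ q₃ → Cover (_≡ p)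
    sunflower c₁ c₂ c₃ q₁≢q₂ q₁≢q₃ q₂≢q₃ u v e with edge-at-or-between c₁ c₂ q₁≢q₂ e | c₃ u v e
    ... | inj₁ at-p | _ = at-p
    ... | inj₂ _ | inj₁ (inj₁ u≡p) = inj₁ u≡p
    ... | inj₂ _ | inj₂ (inj₁ v≡p) = inj₂ v≡p
    ... | inj₂ (inj₁ (refl , _)) | inj₁ (inj₂ u≡q₃) = ⊥-elim (q₁≢q₃ u≡q₃)
    ... | inj₂ (inj₂ (refl , _)) | inj₁ (inj₂ u≡q₃) = ⊥-elim (q₂≢q₃ u≡q₃)
    ... | inj₂ (inj₁ (_ , refl)) | inj₂ (inj₂ v≡q₃) = ⊥-elim (q₂≢q₃ v≡q₃)
    ... | inj₂ (inj₂ (_ , refl)) | inj₂ (inj₂ v≡q₃) = ⊥-elim (q₁≢q₃ v≡q₃)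

    triangle⇒K3 : ∀ {q₁ q₂} → p ≢ q₁ → p ≢ q₂ → q₁ ≢ q₂ →
                  Cover (_∈⟨ p , q₁ ⟩) → Cover (_∈⟨ p , q₂ ⟩) → Cover (_∈⟨ q₁ , q₂ ⟩) →
                  NoSingleCover → IsK3PlusIsolated G
    triangle⇒K3 {p} {q₁} {q₂} p≢q₁ p≢q₂ q₁≢q₂ c₁ c₂ c₃ noSingleCover =
      p , q₁ , q₂ , p≢q₁ , q₁≢q₂ , p≢q₂ ,
      λ u v → mk⇔ edge [ Adj-SamePair p-q₁ , [ Adj-SamePair q₁-q₂ , Adj-SamePair q₂-p ] ]
      where
      Side : Fin n → Fin n → Set
      Side u v = SamePair p q₁ u v ⊎ SamePair q₁ q₂ u v ⊎ SamePair q₂ p u v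

      neighbour : Adj G p v → v ∈⟨ q₁ , q₂ ⟩
      neighbour {v} e = [ (λ { (inj₁ refl) → ⊥-elim (p≢q₁ refl)
                             ; (inj₂ refl) → ⊥-elim (p≢q₂ refl) }) , id ] (c₃ p v e)

      edge : Adj G u v → Side u v
      edge e with edge-at-or-between c₁ c₂ q₁≢q₂ e
      ... | inj₂ s = inj₂ (inj₁ s)
      ... | inj₁ (inj₁ refl) = [ (λ { refl → inj₁ (inj₁ (refl , refl)) })
                               , (λ { refl → inj₂ (inj₂ (inj₂ (refl , refl))) }) ] (neighbour e)
      ... | inj₁ (inj₂ refl) = [ (λ { refl → inj₁ (inj₂ (refl , refl)) })
                               , (λ { refl → inj₂ (inj₂ (inj₁ (refl , refl))) }) ] (neighbour (Adj-sym e))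

      cover : ∀ {P} → EdgeCovered P p q₁ → EdgeCovered P q₁ q₂ → EdgeCovered P q₂ p → Cover P
      cover = Cover-from-sides edge

      p-q₁ : Adj G p q₁
      p-q₁ = Adj-stable λ ¬e → noSingleCover q₂
        (cover (⊥-elim ∘ ¬e) (λ _ → inj₂ refl) (λ _ → inj₁ refl))

      q₁-q₂ : Adj G q₁ q₂
      q₁-q₂ = Adj-stable λ ¬e → noSingleCover p
        (cover (λ _ → inj₁ refl) (⊥-elim ∘ ¬e) (λ _ → inj₂ refl))

      q₂-p : Adj G q₂ p
      q₂-p = Adj-stable λ ¬e → noSingleCover q₁
        (cover (λ _ → inj₂ refl) (λ _ → inj₁ refl) (⊥-elim ∘ ¬e))

    edge-crosses : ¬ Meets a b c d → Cover (_∈⟨ a , b ⟩) → Cover (_∈⟨ c , d ⟩) →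
                   Adj G u v → Crossing a b c d u v
    edge-crosses {u = u} {v} ab∩cd=∅ c₁ c₂ e with c₁ u v e | c₂ u v e
    ... | inj₁ u∈ab | inj₁ u∈cd = ⊥-elim (ab∩cd=∅ (u , u∈ab , u∈cd))
    ... | inj₁ u∈ab | inj₂ v∈cd = u , v , u∈ab , v∈cd , inj₁ (refl , refl)
    ... | inj₂ v∈ab | inj₁ u∈cd = v , u , v∈ab , u∈cd , inj₂ (refl , refl)
    ... | inj₂ v∈ab | inj₂ v∈cd = ⊥-elim (ab∩cd=∅ (v , v∈ab , v∈cd))

    crossing⇒P4 : a ≢ b → c ≢ d → ¬ Meets a b c d →
                  Cover (_∈⟨ a , b ⟩) → Cover (_∈⟨ c , d ⟩) → Cover (_∈⟨ b , c ⟩) →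
                  ¬ Cover (_∈⟨ a , d ⟩) → NoSingleCover → IsP4PlusIsolated G
    crossing⇒P4 {a} {b} {c} {d} a≢b c≢d ab∩cd=∅ c-ab c-cd c-bc ¬c-ad noSingleCover =
      a , c , b , d , a≢c , a≢b , a≢d , b≢c ∘ ≡.sym , c≢d , b≢d ,
      λ u v → mk⇔ edge [ Adj-SamePair a-c , [ Adj-SamePair c-b , Adj-SamePair b-d ] ]
      where
      a≢c = ¬Meets⇒≢ ab∩cd=∅ (inj₁ refl) (inj₁ refl)
      a≢d = ¬Meets⇒≢ ab∩cd=∅ (inj₁ refl) (inj₂ refl)
      b≢c = ¬Meets⇒≢ ab∩cd=∅ (inj₂ refl) (inj₁ refl)
      b≢d = ¬Meets⇒≢ ab∩cd=∅ (inj₂ refl) (inj₂ refl)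

      ¬a-d : ¬ Adj G a d
      ¬a-d e with Cover⇒Meets c-bc e
      ... | _ , inj₁ refl , inj₁ b≡a = a≢b (≡.sym b≡a)
      ... | _ , inj₁ refl , inj₂ b≡d = b≢d b≡d
      ... | _ , inj₂ refl , inj₁ c≡a = a≢c (≡.sym c≡a)
      ... | _ , inj₂ refl , inj₂ c≡d = c≢d c≡d

      Path : Fin n → Fin n → Set
      Path u v = SamePair a c u v ⊎ SamePair c b u v ⊎ SamePair b d u v

      edge : Adj G u v → Path u v
      edge e with edge-crosses ab∩cd=∅ c-ab c-cd e
      ... | _ , _ , inj₁ refl , inj₁ refl , s = inj₁ s
      ... | _ , _ , inj₁ refl , inj₂ refl , s = ⊥-elim (¬a-d (Adj-SamePair e (SamePair-sym s)))
      ... | _ , _ , inj₂ refl , inj₁ refl , s = inj₂ (inj₁ (SamePair-swapˡ s))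
      ... | _ , _ , inj₂ refl , inj₂ refl , s = inj₂ (inj₂ s)

      cover : ∀ {P} → EdgeCovered P a c → EdgeCovered P c b → EdgeCovered P b d → Cover P
      cover = Cover-from-sides edge

      a-c : Adj G a c
      a-c = Adj-stable λ ¬e → noSingleCover b
        (cover (⊥-elim ∘ ¬e) (λ _ → inj₂ refl) (λ _ → inj₁ refl))

      c-b : Adj G c b
      c-b = Adj-stable λ ¬e → ¬c-ad
        (cover (λ _ → inj₁ (inj₁ refl)) (⊥-elim ∘ ¬e) (λ _ → inj₂ (inj₂ refl)))

      b-d : Adj G b d
      b-d = Adj-stable λ ¬e → noSingleCover c
        (cover (λ _ → inj₂ refl) (λ _ → inj₁ refl) (⊥-elim ∘ ¬e))

    OnlyPairCovers : Fin n → Fin n → Fin n → Fin n → Fin n → Fin n → Set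
    OnlyPairCovers a b c d x y =
      ∀ {u v} → PairCover u v → SamePair a b u v ⊎ SamePair c d u v ⊎ SamePair x y u v

    -- A vertex outside {a,b,c,d} is isolated, so it lies in no cover of size 2.
    PairCover-within : ¬ Meets a b c d → Cover (_∈⟨ a , b ⟩) → Cover (_∈⟨ c , d ⟩) →
                       NoSingleCover → PairCover x y → x ∈⟨ a , b ⟩ ⊎ x ∈⟨ c , d ⟩
    PairCover-within {a} {b} {c} {d} {x} {y} ab∩cd=∅ c-ab c-cd noSingleCover (_ , c-xy) =
      decidable-stable (x ∈⟨ a , b ⟩? ⊎-dec x ∈⟨ c , d ⟩?) λ x∉abcd →
        noSingleCover y (isolated-cover
          (λ v e → x∉abcd (Crossing-endpoint (edge-crosses ab∩cd=∅ c-ab c-cd e))) c-xy)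

    PairCover-swap : PairCover x y → PairCover y x
    PairCover-swap (x≢y , c-xy) = x≢y ∘ ≡.sym , Cover-mono Sum.swap c-xy

    third-cover-crosses : ¬ Meets a b c d → Cover (_∈⟨ a , b ⟩) → Cover (_∈⟨ c , d ⟩) →
                          PairCover x y → ¬ SamePair a b x y → ¬ SamePair c d x y →
                          NoSingleCover → Crossing a b c d x y
    third-cover-crosses {x = x} {y} ab∩cd=∅ c-ab c-cd pc-xy@(x≢y , _) ab≁xy cd≁xy noSingleCover
      with PairCover-within ab∩cd=∅ c-ab c-cd noSingleCover pc-xy
         | PairCover-within ab∩cd=∅ c-ab c-cd noSingleCover (PairCover-swap pc-xy)
    ... | inj₁ x∈ab | inj₁ y∈ab = ⊥-elim (ab≁xy (∈⟨⟩⇒SamePair x∈ab y∈ab x≢y))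
    ... | inj₁ x∈ab | inj₂ y∈cd = x , y , x∈ab , y∈cd , SamePair-refl
    ... | inj₂ x∈cd | inj₁ y∈ab = y , x , y∈ab , x∈cd , inj₂ (refl , refl)
    ... | inj₂ x∈cd | inj₂ y∈cd = ⊥-elim (cd≁xy (∈⟨⟩⇒SamePair x∈cd y∈cd x≢y))

    disjoint⇒P4 : ¬ Meets a b c d → PairCover a b → PairCover c d → PairCover x y →
                  ¬ SamePair a b x y → ¬ SamePair c d x y → OnlyPairCovers a b c d x y →
                  NoSingleCover → IsP4PlusIsolated G
    disjoint⇒P4 ab∩cd=∅ (a≢b , c-ab) (c≢d , c-cd) pc-xy@(_ , c-xy) ab≁xy cd≁xy only noSingleCover
      with third-cover-crosses ab∩cd=∅ c-ab c-cd pc-xy ab≁xy cd≁xy noSingleCover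
    ... | s , t , s∈ab , t∈cd , st~xy with partner s∈ab | partner t∈cd
    ... | s′ , ab~ss′ | t′ , cd~tt′ =
      crossing⇒P4 s′≢s (SamePair-≢ c≢d cd~tt′) s′s∩tt′=∅
        (Cover-SamePair ab~s′s c-ab) (Cover-SamePair cd~tt′ c-cd)
        (Cover-SamePair (SamePair-sym st~xy) c-xy) ¬c-s′t′ noSingleCover
      where
      ab~s′s = SamePair-swapʳ ab~ss′
      s′≢s = SamePair-≢ a≢b ab~s′s
      s′∈ab = SamePair⇒∈ˡ ab~s′s
      t′∈cd = SamePair⇒∈ʳ cd~tt′

      s′s∩tt′=∅ : ¬ Meets s′ s t t′
      s′s∩tt′=∅ = ab∩cd=∅ ∘ Meets-SamePair (SamePair-sym ab~s′s) (SamePair-sym cd~tt′)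

      ¬c-s′t′ : ¬ Cover (_∈⟨ s′ , t′ ⟩)
      ¬c-s′t′ c-s′t′ with only (¬Meets⇒≢ ab∩cd=∅ s′∈ab t′∈cd , c-s′t′)
      ... | inj₁ ab~s′t′ = ab∩cd=∅ (t′ , SamePair⇒∈ʳ ab~s′t′ , t′∈cd)
      ... | inj₂ (inj₁ cd~s′t′) = ab∩cd=∅ (s′ , s′∈ab , SamePair⇒∈ˡ cd~s′t′)
      ... | inj₂ (inj₂ xy~s′t′) with SamePair⇒∈ˡ (SamePair-trans st~xy xy~s′t′)
      ...   | inj₁ s′≡s = s′≢s s′≡s
      ...   | inj₂ s′≡t = ¬Meets⇒≢ ab∩cd=∅ s′∈ab t∈cd s′≡t

    meeting⇒K3 : ∀ {x₁ y₁ x₂ y₂ x₃ y₃} →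
                 PairCover x₁ y₁ → PairCover x₂ y₂ → PairCover x₃ y₃ →
                 ¬ SamePair x₁ y₁ x₂ y₂ → ¬ SamePair x₁ y₁ x₃ y₃ → ¬ SamePair x₂ y₂ x₃ y₃ →
                 Meets x₁ y₁ x₂ y₂ → Meets x₁ y₁ x₃ y₃ → Meets x₂ y₂ x₃ y₃ →
                 NoSingleCover → IsK3PlusIsolated G
    meeting⇒K3 {x₃ = x₃} {y₃} (x₁≢y₁ , c₁) (x₂≢y₂ , c₂) (_ , c₃) 1≁2 1≁3 2≁3
               (p , p∈₁ , p∈₂) m₁₃ m₂₃ noSingleCover
      with partner p∈₁ | partner p∈₂ | p ∈⟨ x₃ , y₃ ⟩?
    ... | q₁ , s₁ | q₂ , s₂ | yes p∈₃ with partner p∈₃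
    ...   | q₃ , s₃ = ⊥-elim (noSingleCover p
            (sunflower (Cover-SamePair s₁ c₁) (Cover-SamePair s₂ c₂)
                       (Cover-SamePair s₃ c₃)
                       (partners-distinct 1≁2 s₁ s₂) (partners-distinct 1≁3 s₁ s₃)
                       (partners-distinct 2≁3 s₂ s₃)))
    meeting⇒K3 (x₁≢y₁ , c₁) (x₂≢y₂ , c₂) (_ , c₃) 1≁2 _ _ _ m₁₃ m₂₃ noSingleCover
      | q₁ , s₁ | q₂ , s₂ | no p∉₃ =
      triangle⇒K3 (SamePair-≢ x₁≢y₁ s₁) (SamePair-≢ x₂≢y₂ s₂) q₁≢q₂
        (Cover-SamePair s₁ c₁) (Cover-SamePair s₂ c₂)
        (Cover-SamePair (∈⟨⟩⇒SamePair q₁∈₃ q₂∈₃ q₁≢q₂) c₃) noSingleCover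
      where
      q₁≢q₂ = partners-distinct 1≁2 s₁ s₂
      q₁∈₃ = Meets-via-partner p∉₃ (Meets-SamePair s₁ SamePair-refl m₁₃)
      q₂∈₃ = Meets-via-partner p∉₃ (Meets-SamePair s₂ SamePair-refl m₂₃)

    record ThreePairCovers : Set where
      field
        x₁ y₁ x₂ y₂ x₃ y₃ : Fin n
        cover₁ : PairCover x₁ y₁
        cover₂ : PairCover x₂ y₂
        cover₃ : PairCover x₃ y₃
        distinct₁₂ : ¬ SamePair x₁ y₁ x₂ y₂
        distinct₁₃ : ¬ SamePair x₁ y₁ x₃ y₃
        distinct₂₃ : ¬ SamePair x₂ y₂ x₃ y₃
        only : OnlyPairCovers x₁ y₁ x₂ y₂ x₃ y₃

    module _ (three : ThreePairCovers) where
      open ThreePairCovers three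

      ThreePairCovers⇒K3⊎P4 : NoSingleCover → IsK3PlusIsolated G ⊎ IsP4PlusIsolated G
      ThreePairCovers⇒K3⊎P4 noSingleCover
        with meets? x₁ y₁ x₂ y₂ | meets? x₁ y₁ x₃ y₃ | meets? x₂ y₂ x₃ y₃
      ... | no 1∩2=∅ | _ | _ =
        inj₂ (disjoint⇒P4 1∩2=∅ cover₁ cover₂ cover₃ distinct₁₃ distinct₂₃ only noSingleCover)
      ... | yes _ | no 1∩3=∅ | _ =
        inj₂ (disjoint⇒P4 1∩3=∅ cover₁ cover₃ cover₂ distinct₁₂ (distinct₂₃ ∘ SamePair-sym)
                          (Sum.map₂ Sum.swap ∘ only) noSingleCover)
      ... | yes _ | yes _ | no 2∩3=∅ =
        inj₂ (disjoint⇒P4 2∩3=∅ cover₂ cover₃ cover₁ (distinct₁₂ ∘ SamePair-sym)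
                          (distinct₁₃ ∘ SamePair-sym) ([ inj₂ ∘ inj₂ , Sum.map₂ inj₁ ] ∘ only)
                          noSingleCover)
      ... | yes m₁₂ | yes m₁₃ | yes m₂₃ =
        inj₁ (meeting⇒K3 cover₁ cover₂ cover₃ distinct₁₂ distinct₁₃ distinct₂₃ m₁₂ m₁₃ m₂₃
                         noSingleCover)

    CoverOfSize : ℕ → Subset n → Set
    CoverOfSize k S = ∣ S ∣ ≡ k × IsVertexCover G S

    coverOfSize? : ∀ k S → Dec (CoverOfSize k S)
    coverOfSize? k S = (∣ S ∣ ℕ.≟ k) ×-dec isVertexCover? G S

    ∈-covers⁺ : ∀ {k S} → CoverOfSize k S → S List.∈ filter (coverOfSize? k) (allSubsets n)
    ∈-covers⁺ {k} {S} = ∈-filter⁺ (coverOfSize? k) (allSubsets-complete S)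

    ∈-covers⁻ : ∀ {k S} → S List.∈ filter (coverOfSize? k) (allSubsets n) → CoverOfSize k S
    ∈-covers⁻ {k} = proj₂ ∘ ∈-filter⁻ (coverOfSize? k) {xs = allSubsets n}

    numCovers≡0⇒NoSingleCover : numCovers G 1 ≡ 0 → NoSingleCover
    numCovers≡0⇒NoSingleCover none w cover =
      ∈⇒length≢0 (∈-covers⁺ (∣⁅x⁆∣≡1 w , Cover-mono (λ { refl → x∈⁅x⁆ w }) cover)) none

    PairCover⇒CoverOfSize2 : PairCover u v → CoverOfSize 2 (⁅ u ⁆ ∪ ⁅ v ⁆)
    PairCover⇒CoverOfSize2 {u} {v} (u≢v , cover) =
      ∣⁅x⁆∪⁅y⁆∣≡2 u v u≢v , Cover-mono ∈⁅x⁆∪⁅y⁆⁺ cover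

    CoverOfSize2⇒PairCover : ∀ {S} → CoverOfSize 2 S → ∃[ x ] ∃[ y ] S ≡ ⁅ x ⁆ ∪ ⁅ y ⁆ × PairCover x y
    CoverOfSize2⇒PairCover {S} (∣S∣≡2 , cover) with ∣p∣≡2⇒p≡⁅x⁆∪⁅y⁆ S ∣S∣≡2
    ... | x , y , x≢y , refl = x , y , refl , x≢y , Cover-mono ∈⁅x⁆∪⁅y⁆⁻ cover

    numCovers≡3⇒ThreePairCovers : numCovers G 2 ≡ 3 → ThreePairCovers
    numCovers≡3⇒ThreePairCovers exactlyThree =
      fromList _ (Unique.filter⁺ (coverOfSize? 2) (allSubsets-unique n)) exactlyThree
               ∈-covers⁻ ∈-covers⁺
      where
      fromList : ∀ Ss → Unique Ss → length Ss ≡ 3 →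
                 (∀ {S} → S List.∈ Ss → CoverOfSize 2 S) →
                 (∀ {S} → CoverOfSize 2 S → S List.∈ Ss) → ThreePairCovers
      fromList (A ∷ B ∷ C ∷ []) ((A≢B ∷ A≢C ∷ []) ∷ (B≢C ∷ []) ∷ [] ∷ []) _ sound complete
        with CoverOfSize2⇒PairCover (sound (here refl))
           | CoverOfSize2⇒PairCover (sound (there (here refl)))
           | CoverOfSize2⇒PairCover (sound (there (there (here refl))))
      ... | x₁ , y₁ , refl , pc₁ | x₂ , y₂ , refl , pc₂ | x₃ , y₃ , refl , pc₃ = record
        { cover₁ = pc₁ ; cover₂ = pc₂ ; cover₃ = pc₃
        ; distinct₁₂ = A≢B ∘ SamePair⇒⁅⁆∪⁅⁆≡
        ; distinct₁₃ = A≢C ∘ SamePair⇒⁅⁆∪⁅⁆≡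
        ; distinct₂₃ = B≢C ∘ SamePair⇒⁅⁆∪⁅⁆≡
        ; only = λ pc → which pc (complete (PairCover⇒CoverOfSize2 pc))
        }
        where
        which : PairCover u v → ⁅ u ⁆ ∪ ⁅ v ⁆ List.∈ (A ∷ B ∷ C ∷ []) →
                SamePair x₁ y₁ u v ⊎ SamePair x₂ y₂ u v ⊎ SamePair x₃ y₃ u v
        which (u≢v , _) (here eq) = inj₁ (⁅⁆∪⁅⁆≡⇒SamePair u≢v eq)
        which (u≢v , _) (there (here eq)) = inj₂ (inj₁ (⁅⁆∪⁅⁆≡⇒SamePair u≢v eq))
        which (u≢v , _) (there (there (here eq))) = inj₂ (inj₂ (⁅⁆∪⁅⁆≡⇒SamePair u≢v eq))

-- The hypothesis on covers of size 0 is redundant given the other two.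
lemma5p2 : ∀ {n : ℕ} (C : Graph n) →
    numCovers C 0 ≡ 0 → numCovers C 1 ≡ 0 → numCovers C 2 ≡ 3 →
    IsK3PlusIsolated C ⊎ IsP4PlusIsolated C
lemma5p2 C _ none exactlyThree =
  ThreePairCovers⇒K3⊎P4 C (numCovers≡3⇒ThreePairCovers C exactlyThree)
                          (numCovers≡0⇒NoSingleCover C none)
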